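{- Every good network $\mathcal{N}=(N,\{R_\tau\}_{\tau\in\mathsf{T}},\nu)$ satisfies, for all $\tau,\tau',\sigma,\sigma'\in\mathsf{T}$: (1) $R_{\tau\cdot\tau'}\subseteq R_\tau\cap R_{\tau'}$; (2) $R_{\sigma+\sigma'}\subseteq(R_\sigma\cup R_{\sigma'})^\ast$, where $^\ast$ denotes reflexive transitive closure.
   Context: Fix a finite set $\mathsf{AT}$ of atomic terms and a countable set $\mathsf{AF}$ of atomic formulas; terms $\mathsf{T}$: $\tau::=x\mid\tau+\tau\mid\tau\cdot\tau$; formulas $\varphi::=p\mid\neg\varphi\mid\varphi\vee\varphi\mid\langle\tau\rangle\varphi$, $[\tau]\varphi:=\neg\langle\tau\rangle\neg\varphi$. $S5\mathsf{LCDK}$: propositional tautologies, Modus Ponens, Necessitation, axioms K, T, 4, 5 for each $[\tau]$, dual, the lattice equivalences $\langle\alpha\rangle\varphi\leftrightarrow\langle\beta\rangle\varphi$ for idempotency, commutativity, associativity of $\cdot,+$ and absorption, FP $\langle\tau+\sigma\rangle\varphi\leftrightarrow(\varphi\vee\langle\tau\rangle\langle\tau+\sigma\rangle\varphi\vee\langle\sigma\rangle\langle\tau+\sigma\rangle\varphi)$, INDUC $[\tau+\sigma](\varphi\to([\tau]\varphi\wedge[\sigma]\varphi))\to(\varphi\to[\tau+\sigma]\varphi)$. $\tau\le\sigma$ iff $\langle\tau\rangle\varphi\to\langle\sigma\rangle\varphi$ is derivable; $\uparrow\sigma=\{\tau\mid\sigma\le\tau\}$. For finite $\Sigma$, $\neg\mathrm{FL}(\Sigma)$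 is the smallest set containing $\Sigma$, closed under subformulas and single negation, with $\langle\tau\cdot\sigma\rangle\varphi\in$ implying $\langle\tau\rangle\varphi\wedge\langle\sigma\rangle\varphi\in$ and $\langle\tau+\sigma\rangle\varphi\in$ implying $\langle\tau\rangle\langle\tau+\sigma\rangle\varphi,\langle\sigma\rangle\langle\tau+\sigma\rangle\varphi\in$. Atoms: maximal $S5\mathsf{LCDK}$-consistent subsets of $\neg\mathrm{FL}(\Sigma)$ (set $At(\Sigma)$); $\hat A$ = conjunction of $A$. A network is $(N,\{R_\tau\}_{\tau\in\mathsf{T}},\nu)$, $R_\tau\subseteq N\times N$, $\nu:N\to At(\Sigma)$. Walks/paths as usual (paths have distinct nodes); a $\tau$-walk uses only $R_\tau$; $(u)$ is a $\tau$-path. Coherent: (C0) each $R_\tau$ symmetric; (C1) $uR_\tau v\Rightarrow\widehat{\nu(u)}\wedge\langle\tau\rangle\widehat{\nu(v)}$ consistent; (C2) $uR_\tau v$ and $\tau\le\tau'$ $\Rightarrow uR_{\tau'}v$; (C3) if $u\ne v$ and there is a path from $u$ to $v$ then there is $\sigma$ with $\uparrow\sigma=\{\tau\mid\text{there is a }\tau\text{ -walk from }u\text{ to }v\}$. Saturated: (S1) if $uR_{\sigma+\sigma'}v$ then there is a path from $u$ to $v$ each step of which is $R_\sigma$ or $R_{\sigma'}$; (S2) if $\langle\tau\rangle\psi\in\nu(u)$ then there is $v$ with $uR_\tau v$ and $\psi\in\nu(v)$. Good = coherent and saturated. -}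

module Defs where

open import Data.Nat using (ℕ)
open import Data.Fin using (Fin)
open import Data.Bool using (Bool; true; false; not; _∨_)
open import Data.List using (List; []; _∷_)
open import Data.List.Membership.Propositional using (_∈_; _∉_)
open import Data.List.Relation.Unary.All using (All)
open import Data.List.Relation.Unary.Unique.Propositional using (Unique)
open import Data.Product using (Σ; ∃; _×_)
open import Data.Sum using (_⊎_)
open import Relation.Nullary using (¬_)
open import Relation.Binary.PropositionalEquality using (_≡_)
open import Relation.Binary.Construct.Closure.ReflexiveTransitive using (Star; ε; _◅_)

-- Syntax.  AT = Fin n (a finite set of atomic terms, n a parameter),
-- AF = ℕ (a countable set of atomic formulas).

data Term (n : ℕ) : Set where
  var  : Fin n → Term n
  _⊕_  : Term n → Term n → Term n
  _⊙_  : Term n → Term n → Term n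

infixl 6 _⊕_
infixl 7 _⊙_

data Form (n : ℕ) : Set where
  atom : ℕ → Form n
  neg  : Form n → Form n
  _∨ᶠ_ : Form n → Form n → Form n
  ⟨_⟩_ : Term n → Form n → Form n

infixr 4 _∨ᶠ_
infixr 8 ⟨_⟩_

module _ {n : ℕ} where
  infixr 2 _⇔_
  infixr 3 _⇒_
  infixr 5 _∧ᶠ_
  infixr 8 [_]_
  infix 1 ⊢_

  [_]_ : Term n → Form n → Form n
  [ τ ] φ = neg (⟨ τ ⟩ neg φ)

  _∧ᶠ_ : Form n → Form n → Form n
  φ ∧ᶠ ψ = neg (neg φ ∨ᶠ neg ψ)

  _⇒_ : Form n → Form n → Form n
  φ ⇒ ψ = neg φ ∨ᶠ ψ

  _⇔_ : Form n → Form n → Form n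
  φ ⇔ ψ = (φ ⇒ ψ) ∧ᶠ (ψ ⇒ φ)

  ⊤ᶠ : Form n
  ⊤ᶠ = atom 0 ⇒ atom 0

  eval : (Form n → Bool) → Form n → Bool
  eval v (atom p)    = v (atom p)
  eval v (neg φ)     = not (eval v φ)
  eval v (φ ∨ᶠ ψ)    = eval v φ ∨ eval v ψ
  eval v (⟨ τ ⟩ φ)   = v (⟨ τ ⟩ φ)

  Taut : Form n → Set
  Taut φ = (v : Form n → Bool) → eval v φ ≡ true

  data LatEq : Term n → Term n → Set where
    idem·  : ∀ τ → LatEq (τ ⊙ τ) τ
    idem+  : ∀ τ → LatEq (τ ⊕ τ) τ
    comm·  : ∀ τ σ → LatEq (τ ⊙ σ) (σ ⊙ τ)
    comm+  : ∀ τ σ → LatEq (τ ⊕ σ) (σ ⊕ τ)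
    assoc· : ∀ τ σ ρ → LatEq ((τ ⊙ σ) ⊙ ρ) (τ ⊙ (σ ⊙ ρ))
    assoc+ : ∀ τ σ ρ → LatEq ((τ ⊕ σ) ⊕ ρ) (τ ⊕ (σ ⊕ ρ))
    absorb· : ∀ τ σ → LatEq (τ ⊙ (τ ⊕ σ)) τ
    absorb+ : ∀ τ σ → LatEq (τ ⊕ (τ ⊙ σ)) τ

  data ⊢_ : Form n → Set where
    taut  : ∀ {φ} → Taut φ → ⊢ φ
    mp    : ∀ {φ ψ} → ⊢ (φ ⇒ ψ) → ⊢ φ → ⊢ ψ
    nec   : ∀ {φ} τ → ⊢ φ → ⊢ ([ τ ] φ)
    axK   : ∀ τ φ ψ → ⊢ ([ τ ] (φ ⇒ ψ) ⇒ ([ τ ] φ ⇒ [ τ ] ψ))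
    axT   : ∀ τ φ → ⊢ ([ τ ] φ ⇒ φ)
    ax4   : ∀ τ φ → ⊢ ([ τ ] φ ⇒ [ τ ] [ τ ] φ)
    ax5   : ∀ τ φ → ⊢ (⟨ τ ⟩ φ ⇒ [ τ ] ⟨ τ ⟩ φ)
    dual  : ∀ τ φ → ⊢ (⟨ τ ⟩ φ ⇔ neg ([ τ ] neg φ))
    lat   : ∀ {α β} → LatEq α β → ∀ φ → ⊢ (⟨ α ⟩ φ ⇔ ⟨ β ⟩ φ)
    fp    : ∀ τ σ φ → ⊢ (⟨ τ ⊕ σ ⟩ φ ⇔
                          (φ ∨ᶠ (⟨ τ ⟩ ⟨ τ ⊕ σ ⟩ φ ∨ᶠ ⟨ σ ⟩ ⟨ τ ⊕ σ ⟩ φ)))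
    induc : ∀ τ σ φ → ⊢ ([ τ ⊕ σ ] (φ ⇒ ([ τ ] φ ∧ᶠ [ σ ] φ))
                          ⇒ (φ ⇒ [ τ ⊕ σ ] φ))

  Consistent : Form n → Set
  Consistent φ = ¬ (⊢ neg φ)

  _≤ₜ_ : Term n → Term n → Set
  τ ≤ₜ σ = ∀ φ → ⊢ (⟨ τ ⟩ φ ⇒ ⟨ σ ⟩ φ)

  ∼_ : Form n → Form n
  ∼ neg φ     = φ
  ∼ atom p    = neg (atom p)
  ∼ (φ ∨ᶠ ψ)  = neg (φ ∨ᶠ ψ)
  ∼ (⟨ τ ⟩ φ) = neg (⟨ τ ⟩ φ)

  -- ¬FL(Σ), as an inductively defined (smallest closed) set
  data FL (Σ₀ : List (Form n)) : Form n → Set where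
    base  : ∀ {φ} → φ ∈ Σ₀ → FL Σ₀ φ
    subN  : ∀ {φ} → FL Σ₀ (neg φ) → FL Σ₀ φ
    subL  : ∀ {φ ψ} → FL Σ₀ (φ ∨ᶠ ψ) → FL Σ₀ φ
    subR  : ∀ {φ ψ} → FL Σ₀ (φ ∨ᶠ ψ) → FL Σ₀ ψ
    subD  : ∀ {τ φ} → FL Σ₀ (⟨ τ ⟩ φ) → FL Σ₀ φ
    sneg  : ∀ {φ} → FL Σ₀ φ → FL Σ₀ (∼ φ)
    prod  : ∀ {τ σ φ} → FL Σ₀ (⟨ τ ⊙ σ ⟩ φ) → FL Σ₀ (⟨ τ ⟩ φ ∧ᶠ ⟨ σ ⟩ φ)
    sumL  : ∀ {τ σ φ} → FL Σ₀ (⟨ τ ⊕ σ ⟩ φ) → FL Σ₀ (⟨ τ ⟩ ⟨ τ ⊕ σ ⟩ φ)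
    sumR  : ∀ {τ σ φ} → FL Σ₀ (⟨ τ ⊕ σ ⟩ φ) → FL Σ₀ (⟨ σ ⟩ ⟨ τ ⊕ σ ⟩ φ)

  conj : List (Form n) → Form n
  conj []       = ⊤ᶠ
  conj (φ ∷ Γ)  = φ ∧ᶠ conj Γ

  record Atom (Σ₀ : List (Form n)) : Set where
    field
      fs      : List (Form n)
      inFL    : All (FL Σ₀) fs
      consis  : Consistent (conj fs)
      maximal : ∀ φ → FL Σ₀ φ → φ ∉ fs → ¬ Consistent (conj (φ ∷ fs))
  open Atom public

nodes : ∀ {N : Set} {E : N → N → Set} {u v} → Star E u v → List N
nodes {u = u} ε        = u ∷ []
nodes {u = u} (e ◅ w)  = u ∷ nodes w

IsPath : ∀ {N : Set} {E : N → N → Set} {u v} → Star E u v → Set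
IsPath w = Unique (nodes w)

PathIn : ∀ {N : Set} → (N → N → Set) → N → N → Set
PathIn E u v = Σ (Star E u v) IsPath

record Network (n : ℕ) (Σ₀ : List (Form n)) : Set₁ where
  field
    Node : Set
    R    : Term n → Node → Node → Set
    ν    : Node → Atom Σ₀
open Network public

module _ {n : ℕ} {Σ₀ : List (Form n)} (𝒩 : Network n Σ₀) where

  private
    N = Node 𝒩
    Rₙ = R 𝒩
    νₙ = ν 𝒩

  AnyEdge : N → N → Set
  AnyEdge u v = Σ (Term n) λ τ → Rₙ τ u v

  record Coherent : Set where
    field
      C0 : ∀ τ u v → Rₙ τ u v → Rₙ τ v u
      C1 : ∀ τ u v → Rₙ τ u v →
             Consistent (conj (fs (νₙ u)) ∧ᶠ ⟨ τ ⟩ conj (fs (νₙ v)))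
      C2 : ∀ τ τ' u v → Rₙ τ u v → τ ≤ₜ τ' → Rₙ τ' u v
      C3 : ∀ u v → ¬ (u ≡ v) → PathIn AnyEdge u v →
             Σ (Term n) λ σ → ∀ τ → ((σ ≤ₜ τ → Star (Rₙ τ) u v)
                                    × (Star (Rₙ τ) u v → σ ≤ₜ τ))

  record Saturated : Set where
    field
      S1 : ∀ σ σ' u v → Rₙ (σ ⊕ σ') u v →
             PathIn (λ a b → Rₙ σ a b ⊎ Rₙ σ' a b) u v
      S2 : ∀ τ ψ u → (⟨ τ ⟩ ψ) ∈ fs (νₙ u) →
             Σ N λ v → Rₙ τ u v × ψ ∈ fs (νₙ v)

  Good : Set
  Good = Coherent × Saturated

{-# OPTIONS --safe #-}
-- Part (1) is upward closure (C2) applied to the derivable inequalities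
-- τ·τ' ≤ τ and τ·τ' ≤ τ'.  FP gives φ → ⟨τ+σ⟩φ and ⟨τ⟩⟨τ+σ⟩φ → ⟨τ+σ⟩φ,
-- hence τ ≤ τ+σ; with σ := τ this yields τ·τ' ≤ (τ·τ')+τ, which absorption
-- collapses to τ.  Part (2) is the path provided by (S1), read as a walk.
module Submission where

open import Defs
open import Data.Nat using (ℕ)
open import Data.List using (List)
open import Data.Product using (_×_; _,_; proj₁)
open import Data.Sum using (_⊎_)
open import Data.Bool using (true; false)
open import Relation.Binary.PropositionalEquality using (refl)
open import Relation.Binary.Core using () renaming (_⇒_ to _⊆_)
open import Relation.Binary.Construct.Intersection using (_∩_)
open import Relation.Binary.Construct.Union using (_∪_)
open import Relation.Binary.Construct.Closure.ReflexiveTransitive using (Star)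

module _ {n : ℕ} where

  private variable
    A B C : Form n
    τ σ ρ : Term n

  ⇒-trans : ⊢ (A ⇒ B) → ⊢ (B ⇒ C) → ⊢ (A ⇒ C)
  ⇒-trans {A} {B} {C} p q = mp (mp (taut syllogism) p) q
    where
    syllogism : Taut ((A ⇒ B) ⇒ ((B ⇒ C) ⇒ (A ⇒ C)))
    syllogism v with eval v A | eval v B | eval v C
    ... | true  | true  | true  = refl
    ... | true  | true  | false = refl
    ... | true  | false | true  = refl
    ... | true  | false | false = refl
    ... | false | true  | true  = refl
    ... | false | true  | false = refl
    ... | false | false | true  = refl
    ... | false | false | false = refl

  ⇔-to : ⊢ (A ⇔ B) → ⊢ (A ⇒ B)
  ⇔-to {A} {B} = mp (taut ∧-elimˡ)
    where
    ∧-elimˡ : Taut ((A ⇔ B) ⇒ (A ⇒ B))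
    ∧-elimˡ v with eval v A | eval v B
    ... | true  | true  = refl
    ... | true  | false = refl
    ... | false | true  = refl
    ... | false | false = refl

  ⇔-from : ⊢ (A ⇔ B) → ⊢ (B ⇒ A)
  ⇔-from {A} {B} = mp (taut ∧-elimʳ)
    where
    ∧-elimʳ : Taut ((A ⇔ B) ⇒ (B ⇒ A))
    ∧-elimʳ v with eval v A | eval v B
    ... | true  | true  = refl
    ... | true  | false = refl
    ... | false | true  = refl
    ... | false | false = refl

  contraposition : ⊢ (A ⇒ B) → ⊢ (neg B ⇒ neg A)
  contraposition {A} {B} = mp (taut contrapositive)
    where
    contrapositive : Taut ((A ⇒ B) ⇒ (neg B ⇒ neg A))
    contrapositive v with eval v A | eval v B
    ... | true  | true  = refl
    ... | true  | false = refl
    ... | false | true  = refl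
    ... | false | false = refl

  ◇-mono : ∀ τ → ⊢ (A ⇒ B) → ⊢ (⟨ τ ⟩ A ⇒ ⟨ τ ⟩ B)
  ◇-mono {A} {B} τ p =
    ⇒-trans (⇔-to (dual τ A))
      (⇒-trans (contraposition (mp (axK τ (neg B) (neg A)) (nec τ (contraposition p))))
        (⇔-from (dual τ B)))

  ≤ₜ-trans : τ ≤ₜ σ → σ ≤ₜ ρ → τ ≤ₜ ρ
  ≤ₜ-trans p q φ = ⇒-trans (p φ) (q φ)

  LatEq⇒≤ₜ : LatEq τ σ → τ ≤ₜ σ
  LatEq⇒≤ₜ e φ = ⇔-to (lat e φ)

  τ≤τ⊕σ : ∀ τ σ → τ ≤ₜ (τ ⊕ σ)
  τ≤τ⊕σ τ σ φ = ⇒-trans (◇-mono τ (⇒-trans (taut ∨-introˡ) unfold))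
                        (⇒-trans (taut ∨-introʳˡ) unfold)
    where
    P X Y : Form n
    P = ⟨ τ ⊕ σ ⟩ φ
    X = ⟨ τ ⟩ P
    Y = ⟨ σ ⟩ P

    unfold : ⊢ ((φ ∨ᶠ (X ∨ᶠ Y)) ⇒ P)
    unfold = ⇔-from (fp τ σ φ)

    ∨-introˡ : Taut (φ ⇒ (φ ∨ᶠ (X ∨ᶠ Y)))
    ∨-introˡ v with eval v φ
    ... | true  = refl
    ... | false = refl

    ∨-introʳˡ : Taut (X ⇒ (φ ∨ᶠ (X ∨ᶠ Y)))
    ∨-introʳˡ v with eval v φ | eval v X
    ... | true  | true  = refl
    ... | true  | false = refl
    ... | false | true  = refl
    ... | false | false = refl

  τ⊙σ≤τ : ∀ τ σ → (τ ⊙ σ) ≤ₜ τ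
  τ⊙σ≤τ τ σ = ≤ₜ-trans (τ≤τ⊕σ (τ ⊙ σ) τ)
                (≤ₜ-trans (LatEq⇒≤ₜ (comm+ (τ ⊙ σ) τ)) (LatEq⇒≤ₜ (absorb+ τ σ)))

  τ⊙σ≤σ : ∀ τ σ → (τ ⊙ σ) ≤ₜ σ
  τ⊙σ≤σ τ σ = ≤ₜ-trans (LatEq⇒≤ₜ (comm· τ σ)) (τ⊙σ≤τ σ τ)

module _ {n : ℕ} {Σ₀ : List (Form n)} {𝒩 : Network n Σ₀} where

  R-⊙-⊆-∩ : Coherent 𝒩 → ∀ τ τ' → R 𝒩 (τ ⊙ τ') ⊆ (R 𝒩 τ ∩ R 𝒩 τ')
  R-⊙-⊆-∩ coh τ τ' {u} {v} r =
    C2 (τ ⊙ τ') τ u v r (τ⊙σ≤τ τ τ') , C2 (τ ⊙ τ') τ' u v r (τ⊙σ≤σ τ τ')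
    where open Coherent coh

  R-⊕-⊆-Star-∪ : Saturated 𝒩 → ∀ σ σ' → R 𝒩 (σ ⊕ σ') ⊆ Star (R 𝒩 σ ∪ R 𝒩 σ')
  R-⊕-⊆-Star-∪ sat σ σ' {u} {v} r = proj₁ (S1 σ σ' u v r)
    where open Saturated sat

mainTheorem7 : (n : ℕ) (Σ₀ : List (Form n)) (𝒩 : Network n Σ₀) → Good 𝒩 →
    (∀ τ τ' u v → R 𝒩 (τ ⊙ τ') u v → R 𝒩 τ u v × R 𝒩 τ' u v) ×
    (∀ σ σ' u v → R 𝒩 (σ ⊕ σ') u v →
       Star (λ a b → R 𝒩 σ a b ⊎ R 𝒩 σ' a b) u v)
mainTheorem7 n Σ₀ 𝒩 (coh , sat) =
  (λ τ τ' u v → R-⊙-⊆-∩ coh τ τ') , (λ σ σ' u v → R-⊕-⊆-Star-∪ sat σ σ')
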